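{- Let $n\geq0$ and $k\geq2$. For every formula $\alpha$: if $\vDash_{\mathcal{R}_n^k}\alpha$, then $\vdash_{L_n^k}\alpha$.
   Context: Formulas are built from propositional variables using unary $\neg,\circ$ and binary $\land,\lor,\to$; $\circ^0\alpha=\alpha$, $\circ^{m+1}\alpha=\circ\circ^m\alpha$, $\alpha\leftrightarrow\beta:=(\alpha\to\beta)\land(\beta\to\alpha)$. Logics are Hilbert calculi with modus ponens as only rule and axiom schemas. mbC has the positive classical axioms $\alpha\to(\beta\to\alpha)$; $(\alpha\to\beta)\to((\alpha\to(\beta\to\gamma))\to(\alpha\to\gamma))$; $\alpha\to(\beta\to(\alpha\land\beta))$; $(\alpha\land\beta)\to\alpha$; $(\alpha\land\beta)\to\beta$; $\alpha\to(\alpha\lor\beta)$; $\beta\to(\alpha\lor\beta)$; $(\alpha\to\gamma)\to((\beta\to\gamma)\to((\alpha\lor\beta)\to\gamma))$; $\alpha\lor(\alpha\to\beta)$; plus $\alpha\lor\neg\alpha$ and $\circ\alpha\to(\alpha\to(\neg\alpha\to\beta))$. mbCciw = mbC + $\circ\alpha\lor(\alpha\land\neg\alpha)$. $L_n^0$ = mbCciw + (cc$^n$) $\circ^{n+2}\alpha$; $L_n^1$ = $L_n^0$ + (dn) $\neg\neg\alpha\leftrightarrow\alpha$; $L_n^k$ = $L_n^1$ + (ip$^j$) $\neg\circ^j\neg\alpha\leftrightarrow\neg\circ^j\alpha$ for all $1\leq j<k$. $\mathcal{M}_1$ is the Nmatrix (of the logic Cbr) with domain $\{T,t,F\}$, designated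 set $D=\{T,t\}$: for $\#\in\{\land,\lor,\to\}$, $x\#y=\{T,t\}$ if the classical truth function $\#$ applied to the designation status of $x,y$ gives true and $\{F\}$ otherwise; $\neg T=\{F\}$, $\neg t=\{t\}$, $\neg F=\{T\}$; $\circ T=\circ F=\{T,t\}$, $\circ t=\{F\}$. A valuation over $\mathcal{M}_1$ is a map $\vartheta$ from formulas into $\{T,t,F\}$ with $\vartheta(\neg\beta)\in\neg\vartheta(\beta)$, $\vartheta(\circ\beta)\in\circ\vartheta(\beta)$, $\vartheta(\beta\#\gamma)\in\vartheta(\beta)\#\vartheta(\gamma)$. $\mathcal{F}_n^k$ is the set of such valuations satisfying, for all formulas $\beta$: (vCc$^n$) if $\vartheta(\circ^n\beta)\in\{T,F\}$ then $\vartheta(\circ^{n+1}\beta)=T$; and (vip$^j$) $\vartheta(\circ^j\beta)=\vartheta(\circ^j\neg\beta)$ for every $1\leq j\leq k-1$. $\vDash_{\mathcal{R}_n^k}\alpha$ means $\vartheta(\alpha)\in D$ for every $\vartheta\in\mathcal{F}_n^k$. -}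

module Defs where

open import Data.Nat using (ℕ; zero; suc; _+_; _≤_; _<_)
open import Data.Bool using (Bool; true; false; not; if_then_else_)
  renaming (_∧_ to _and_; _∨_ to _or_)
open import Data.Product using (_×_)
open import Data.Sum using (_⊎_)
open import Relation.Binary.PropositionalEquality using (_≡_)

infixr 5 _⇒_
infixl 6 _⋁_
infixl 7 _⋀_
infix 8 ~_ ○_

data Form : Set where
  var  : ℕ → Form
  ~_   : Form → Form
  ○_   : Form → Form
  _⋀_  : Form → Form → Form
  _⋁_  : Form → Form → Form
  _⇒_  : Form → Form → Form

○^ : ℕ → Form → Form
○^ zero    α = α
○^ (suc m) α = ○ (○^ m α)

_⇔_ : Form → Form → Form
α ⇔ β = (α ⇒ β) ⋀ (β ⇒ α)

data Axiom (n k : ℕ) : Form → Set where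
  ax1  : ∀ α β → Axiom n k (α ⇒ (β ⇒ α))
  ax2  : ∀ α β γ → Axiom n k ((α ⇒ β) ⇒ ((α ⇒ (β ⇒ γ)) ⇒ (α ⇒ γ)))
  ax3  : ∀ α β → Axiom n k (α ⇒ (β ⇒ (α ⋀ β)))
  ax4  : ∀ α β → Axiom n k ((α ⋀ β) ⇒ α)
  ax5  : ∀ α β → Axiom n k ((α ⋀ β) ⇒ β)
  ax6  : ∀ α β → Axiom n k (α ⇒ (α ⋁ β))
  ax7  : ∀ α β → Axiom n k (β ⇒ (α ⋁ β))
  ax8  : ∀ α β γ → Axiom n k ((α ⇒ γ) ⇒ ((β ⇒ γ) ⇒ ((α ⋁ β) ⇒ γ)))
  ax9  : ∀ α β → Axiom n k (α ⋁ (α ⇒ β))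
  ax10 : ∀ α → Axiom n k (α ⋁ ~ α)
  bc1  : ∀ α β → Axiom n k (○ α ⇒ (α ⇒ (~ α ⇒ β)))
  ciw  : ∀ α → Axiom n k (○ α ⋁ (α ⋀ ~ α))
  ccn  : ∀ α → Axiom n k (○^ (n + 2) α)
  dn   : 1 ≤ k → ∀ α → Axiom n k ((~ ~ α) ⇔ α)
  ip   : ∀ j → 1 ≤ j → j < k → ∀ α → Axiom n k ((~ (○^ j (~ α))) ⇔ (~ (○^ j α)))

data Thm (n k : ℕ) : Form → Set where
  ax : ∀ {α} → Axiom n k α → Thm n k α
  mp : ∀ {α β} → Thm n k α → Thm n k (α ⇒ β) → Thm n k β

data V : Set where
  T t F : V

des : V → Bool
des T = true
des t = true
des F = false

Designated : V → Set
Designated x = des x ≡ true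

∈tab : Bool → V → Set
∈tab b r = if b then Designated r else r ≡ F

_∈∧_ : V → V → V → Set
(r ∈∧ x) y = ∈tab (des x and des y) r

_∈∨_ : V → V → V → Set
(r ∈∨ x) y = ∈tab (des x or des y) r

_∈⇒_ : V → V → V → Set
(r ∈⇒ x) y = ∈tab (not (des x) or des y) r

_∈¬_ : V → V → Set
r ∈¬ T = r ≡ F
r ∈¬ t = r ≡ t
r ∈¬ F = r ≡ T

_∈○_ : V → V → Set
r ∈○ T = Designated r
r ∈○ t = r ≡ F
r ∈○ F = Designated r

record Valuation : Set where
  field
    val  : Form → V
    v-¬  : ∀ β → val (~ β) ∈¬ val β
    v-○  : ∀ β → val (○ β) ∈○ val β
    v-∧  : ∀ β γ → (val (β ⋀ γ) ∈∧ val β) (val γ)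
    v-∨  : ∀ β γ → (val (β ⋁ γ) ∈∨ val β) (val γ)
    v-⇒  : ∀ β γ → (val (β ⇒ γ) ∈⇒ val β) (val γ)

open Valuation public

InF : ℕ → ℕ → Valuation → Set
InF n k v =
  (∀ β → (val v (○^ n β) ≡ T ⊎ val v (○^ n β) ≡ F) → val v (○^ (suc n) β) ≡ T)
  × (∀ j → 1 ≤ j → suc j ≤ k → ∀ β → val v (○^ j β) ≡ val v (○^ j (~ β)))

Valid : ℕ → ℕ → Form → Set
Valid n k α = ∀ (v : Valuation) → InF n k v → Designated (val v α)

{-# OPTIONS --safe #-}
-- Completeness by a constructive, Kalmár-style case split. Splitting on φ ∨ (φ → ⊥ᶠ) and
-- ~φ ∨ (~φ → ⊥ᶠ), where ⊥ᶠ := ○p ∧ (p ∧ ~p) entails everything by (bc1), for each of the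
-- finitely many formulas φ of rank ≤ rank α gives branches whose hypotheses fix a value of
-- every such φ (T: φ and ¬~φ; t: φ and ~φ; F: ¬φ); it suffices to derive α in each branch.
-- Either the hypotheses of a branch are inconsistent, or the assignment f they describe is
-- admissible: it respects the tables of M₁, gives ○^j ~ρ and ○^j ρ the same value for
-- 1 ≤ j < k, and never gives ○^(n+1) β the value t. An admissible f extends to a valuation in
-- F_n^k that evaluates each ○-tower through its normal form modulo (ip), so the valid α is
-- designated by f, i.e. α is a hypothesis of the branch.

module Submission where

open import Defs
open import Level using (0ℓ)
open import Data.Nat using (ℕ; zero; suc; _+_; _≤_; _<_; _⊔_; s≤s; z≤n; _≤?_; _<?_)
open import Data.Nat.Properties
  using (≤-refl; <⇒≤; m⊔n≤o⇒m≤o; m⊔n≤o⇒n≤o; +-suc; +-comm; +-identityʳ)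
open import Data.Bool using (Bool; true; false; not; _∧_; _∨_)
open import Data.List
  using (List; []; _∷_; _++_; concat; map; applyUpTo; upTo; cartesianProductWith)
open import Data.List.Membership.Propositional using (_∈_)
open import Data.List.Membership.Propositional.Properties
  using (∈-++⁺ˡ; ∈-++⁺ʳ; ∈-concat⁺; ∈-map⁺; ∈-applyUpTo⁺; ∈-upTo⁺; ∈-cartesianProductWith⁺)
open import Data.List.Relation.Unary.Any using (Any; here; there)
open import Data.List.Relation.Unary.All using (All; []; _∷_; lookup; tabulate; sequenceA)
open import Data.List.Relation.Binary.Subset.Propositional using (_⊆_)
open import Data.Product using (_×_; _,_; proj₁; proj₂; ∃)
open import Data.Sum using (_⊎_; inj₁; inj₂; [_,_]′; map₂)
import Data.Sum.Effectful.Left as Sumₗ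
open import Data.Unit using (⊤; tt)
open import Data.Empty using (⊥-elim)
open import Effect.Monad using (RawMonad)
open import Function using (_∘_; id; const)
open import Relation.Nullary using (Dec; yes; no)
open import Relation.Binary.PropositionalEquality
  using (_≡_; _≢_; refl; sym; trans; cong; cong₂; subst)
open Relation.Binary.PropositionalEquality.≡-Reasoning

private
  variable
    Γ Δ : List Form
    φ ψ χ : Form
    x y : V
    N : ℕ

rank : Form → ℕ
rank (var p) = suc p
rank (~ φ) = suc (rank φ)
rank (○ φ) = suc (rank φ)
rank (φ ⋀ ψ) = suc (rank φ ⊔ rank ψ)
rank (φ ⋁ ψ) = suc (rank φ ⊔ rank ψ)
rank (φ ⇒ ψ) = suc (rank φ ⊔ rank ψ)

m⊔n<o⇒m≤o : ∀ {m n o} → m ⊔ n < o → m ≤ o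
m⊔n<o⇒m≤o r = m⊔n≤o⇒m≤o _ _ (<⇒≤ r)

m⊔n<o⇒n≤o : ∀ {m n o} → m ⊔ n < o → n ≤ o
m⊔n<o⇒n≤o r = m⊔n≤o⇒n≤o _ _ (<⇒≤ r)

○^-○ : ∀ m φ → ○^ m (○ φ) ≡ ○ (○^ m φ)
○^-○ zero φ = refl
○^-○ (suc m) φ = cong ○_ (○^-○ m φ)

rank-○^-≤ : ∀ j → rank (○^ j φ) ≤ N → rank φ ≤ N
rank-○^-≤ zero r = r
rank-○^-≤ (suc j) r = rank-○^-≤ j (<⇒≤ r)

rank-○^-~-≤ : ∀ j → rank (○^ j (~ φ)) ≤ N → rank (○^ j φ) ≤ N
rank-○^-~-≤ zero r = <⇒≤ r
rank-○^-~-≤ (suc j) (s≤s r) = s≤s (rank-○^-~-≤ j r)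

forms : ℕ → List Form
layers : ℕ → List (List Form)

forms zero = []
forms (suc M) = concat (layers M)

layers M =
  applyUpTo var (suc M) ∷ map ~_ (forms M) ∷ map ○_ (forms M) ∷
  pairs _⋀_ ∷ pairs _⋁_ ∷ pairs _⇒_ ∷ []
  where
  pairs : (Form → Form → Form) → List Form
  pairs op = cartesianProductWith op (forms M) (forms M)

∈-layers : ∀ M → Any (φ ∈_) (layers M) → φ ∈ forms (suc M)
∈-layers _ = ∈-concat⁺

∈-forms : ∀ {M} φ → rank φ ≤ M → φ ∈ forms M
∈-pairs : ∀ {M} (op : Form → Form → Form) φ ψ → rank φ ⊔ rank ψ ≤ M →
          op φ ψ ∈ cartesianProductWith op (forms M) (forms M)

∈-forms {suc M} (var p) (s≤s r) = ∈-layers M (here (∈-applyUpTo⁺ var (s≤s r)))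
∈-forms {suc M} (~ φ) (s≤s r) = ∈-layers M (there (here (∈-map⁺ ~_ (∈-forms φ r))))
∈-forms {suc M} (○ φ) (s≤s r) = ∈-layers M (there (there (here (∈-map⁺ ○_ (∈-forms φ r)))))
∈-forms {suc M} (φ ⋀ ψ) (s≤s r) =
  ∈-layers M (there (there (there (here (∈-pairs _⋀_ φ ψ r)))))
∈-forms {suc M} (φ ⋁ ψ) (s≤s r) =
  ∈-layers M (there (there (there (there (here (∈-pairs _⋁_ φ ψ r))))))
∈-forms {suc M} (φ ⇒ ψ) (s≤s r) =
  ∈-layers M (there (there (there (there (there (here (∈-pairs _⇒_ φ ψ r)))))))

∈-pairs op φ ψ r =
  ∈-cartesianProductWith⁺ op (∈-forms φ (m⊔n≤o⇒m≤o _ _ r)) (∈-forms ψ (m⊔n≤o⇒n≤o _ _ r))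

-- Derivations from hypotheses

module Derivations (n k : ℕ) where

  infix 3 _⊢_
  data _⊢_ (Γ : List Form) : Form → Set where
    hyp : φ ∈ Γ → Γ ⊢ φ
    axm : Axiom n k φ → Γ ⊢ φ
    mp  : Γ ⊢ φ → Γ ⊢ φ ⇒ ψ → Γ ⊢ ψ

  ⊢⇒Thm : [] ⊢ φ → Thm n k φ
  ⊢⇒Thm (hyp ())
  ⊢⇒Thm (axm a) = ax a
  ⊢⇒Thm (mp d e) = mp (⊢⇒Thm d) (⊢⇒Thm e)

  weaken : Γ ⊆ Δ → Γ ⊢ φ → Δ ⊢ φ
  weaken s (hyp p) = hyp (s p)
  weaken s (axm a) = axm a
  weaken s (mp d e) = mp (weaken s d) (weaken s e)

  ⇒-refl : Γ ⊢ φ ⇒ φ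
  ⇒-refl {φ = φ} = mp (axm (ax1 φ (φ ⇒ φ))) (mp (axm (ax1 φ φ)) (axm (ax2 φ (φ ⇒ φ) φ)))

  deduction : φ ∷ Γ ⊢ ψ → Γ ⊢ φ ⇒ ψ
  deduction (hyp (here refl)) = ⇒-refl
  deduction (hyp (there p)) = mp (hyp p) (axm (ax1 _ _))
  deduction (axm a) = mp (axm a) (axm (ax1 _ _))
  deduction (mp d e) = mp (deduction e) (mp (deduction d) (axm (ax2 _ _ _)))

  ⇒-trans : Γ ⊢ φ ⇒ ψ → Γ ⊢ ψ ⇒ χ → Γ ⊢ φ ⇒ χ
  ⇒-trans d e = deduction (mp (mp (hyp (here refl)) (weaken there d)) (weaken there e))

  ∧-intro : Γ ⊢ φ → Γ ⊢ ψ → Γ ⊢ φ ⋀ ψ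
  ∧-intro d e = mp e (mp d (axm (ax3 _ _)))

  ∧-elimˡ : Γ ⊢ φ ⋀ ψ → Γ ⊢ φ
  ∧-elimˡ d = mp d (axm (ax4 _ _))

  ∧-elimʳ : Γ ⊢ φ ⋀ ψ → Γ ⊢ ψ
  ∧-elimʳ d = mp d (axm (ax5 _ _))

  ∨-introˡ : Γ ⊢ φ → Γ ⊢ φ ⋁ ψ
  ∨-introˡ d = mp d (axm (ax6 _ _))

  ∨-introʳ : Γ ⊢ ψ → Γ ⊢ φ ⋁ ψ
  ∨-introʳ d = mp d (axm (ax7 _ _))

  ∨-elim : Γ ⊢ φ ⋁ ψ → Γ ⊢ φ ⇒ χ → Γ ⊢ ψ ⇒ χ → Γ ⊢ χ
  ∨-elim d e f = mp d (mp f (mp e (axm (ax8 _ _ _))))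

  explode : Γ ⊢ ○ φ → Γ ⊢ φ → Γ ⊢ ~ φ → Γ ⊢ ψ
  explode o d e = mp e (mp d (mp o (axm (bc1 _ _))))

  ⊥ᶠ : Form
  ⊥ᶠ = ○ var 0 ⋀ (var 0 ⋀ ~ var 0)

  ¬ᶠ_ : Form → Form
  ¬ᶠ φ = φ ⇒ ⊥ᶠ

  ⊥ᶠ-elim : Γ ⊢ ⊥ᶠ → Γ ⊢ φ
  ⊥ᶠ-elim d = explode (∧-elimˡ d) (∧-elimˡ (∧-elimʳ d)) (∧-elimʳ (∧-elimʳ d))

  ¬ᶠ-∧ˡ : Γ ⊢ ¬ᶠ φ → Γ ⊢ ¬ᶠ (φ ⋀ ψ)
  ¬ᶠ-∧ˡ = ⇒-trans (axm (ax4 _ _))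

  ¬ᶠ-∧ʳ : Γ ⊢ ¬ᶠ ψ → Γ ⊢ ¬ᶠ (φ ⋀ ψ)
  ¬ᶠ-∧ʳ = ⇒-trans (axm (ax5 _ _))

  ¬ᶠ⇒⇒ : Γ ⊢ ¬ᶠ φ → Γ ⊢ φ ⇒ ψ
  ¬ᶠ⇒⇒ d = ⇒-trans d (deduction (⊥ᶠ-elim (hyp (here refl))))

  by-cases : φ ∷ Γ ⊢ χ → ¬ᶠ φ ∷ Γ ⊢ χ → Γ ⊢ χ
  by-cases d e = ∨-elim (axm (ax9 _ ⊥ᶠ)) (deduction d) (deduction e)

  Forces : List Form → Form → V → Set
  Forces Γ φ T = Γ ⊢ φ × Γ ⊢ ¬ᶠ (~ φ)
  Forces Γ φ t = Γ ⊢ φ × Γ ⊢ ~ φ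
  Forces Γ φ F = Γ ⊢ ¬ᶠ φ

  assumptions : Form → V → List Form
  assumptions φ T = ¬ᶠ (~ φ) ∷ φ ∷ []
  assumptions φ t = ~ φ ∷ φ ∷ []
  assumptions φ F = ¬ᶠ φ ∷ []

  assumptions-force : ∀ φ x → assumptions φ x ⊆ Γ → Forces Γ φ x
  assumptions-force φ T s = hyp (s (there (here refl))) , hyp (s (here refl))
  assumptions-force φ t s = hyp (s (there (here refl))) , hyp (s (here refl))
  assumptions-force φ F s = hyp (s (here refl))

  trichotomy : ∀ φ → (∀ x → assumptions φ x ++ Γ ⊢ χ) → Γ ⊢ χ
  trichotomy φ h = by-cases (by-cases (h t) (h T)) (h F)

  Settled : List Form → Form → Set
  Settled Γ φ = ∃ (Forces Γ φ)

  settle : ∀ xs → (∀ {Δ} → Γ ⊆ Δ → All (Settled Δ) xs → Δ ⊢ χ) → Γ ⊢ χ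
  settle [] h = h id []
  settle (φ ∷ xs) h = trichotomy φ λ x → settle xs λ s settled →
    h (s ∘ ∈-++⁺ʳ _) ((x , assumptions-force φ x (s ∘ ∈-++⁺ˡ)) ∷ settled)

  Decides : List Form → Form → Bool → Set
  Decides Γ φ true = Γ ⊢ φ
  Decides Γ φ false = Γ ⊢ ¬ᶠ φ

  forces⇒decides : ∀ x → Forces Γ φ x → Decides Γ φ (des x)
  forces⇒decides T = proj₁
  forces⇒decides t = proj₁
  forces⇒decides F d = d

  forces-designated : ∀ x → Designated x → Forces Γ φ x → Γ ⊢ φ
  forces-designated x d = subst (Decides _ _) d ∘ forces⇒decides x

  ~-respected : 1 ≤ k → ∀ x y → Forces Γ φ x → Forces Γ (~ φ) y → Γ ⊢ ⊥ᶠ ⊎ y ∈¬ x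
  ~-respected _ T F _ _ = inj₂ refl
  ~-respected _ t t _ _ = inj₂ refl
  ~-respected _ F T _ _ = inj₂ refl
  ~-respected _ T T (_ , ⊢¬~φ) (⊢~φ , _) = inj₁ (mp ⊢~φ ⊢¬~φ)
  ~-respected _ T t (_ , ⊢¬~φ) (⊢~φ , _) = inj₁ (mp ⊢~φ ⊢¬~φ)
  ~-respected _ t F (_ , ⊢~φ) ⊢¬~φ = inj₁ (mp ⊢~φ ⊢¬~φ)
  ~-respected 1≤k t T (⊢φ , _) (_ , ⊢¬~~φ) = inj₁ (mp (mp ⊢φ (∧-elimʳ (axm (dn 1≤k _)))) ⊢¬~~φ)
  ~-respected 1≤k F t ⊢¬φ (_ , ⊢~~φ) = inj₁ (mp (mp ⊢~~φ (∧-elimˡ (axm (dn 1≤k _)))) ⊢¬φ)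
  ~-respected _ F F ⊢¬φ ⊢¬~φ = inj₁ (∨-elim (axm (ax10 _)) ⊢¬φ ⊢¬~φ)

  ○-respected : ∀ x y → Forces Γ φ x → Forces Γ (○ φ) y → Γ ⊢ ⊥ᶠ ⊎ y ∈○ x
  ○-respected T T _ _ = inj₂ refl
  ○-respected T t _ _ = inj₂ refl
  ○-respected t F _ _ = inj₂ refl
  ○-respected F T _ _ = inj₂ refl
  ○-respected F t _ _ = inj₂ refl
  ○-respected T F (_ , ⊢¬~φ) ⊢¬○φ = inj₁ (∨-elim (axm (ciw _)) ⊢¬○φ (¬ᶠ-∧ʳ ⊢¬~φ))
  ○-respected F F ⊢¬φ ⊢¬○φ = inj₁ (∨-elim (axm (ciw _)) ⊢¬○φ (¬ᶠ-∧ˡ ⊢¬φ))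
  ○-respected t T (⊢φ , ⊢~φ) (⊢○φ , _) = inj₁ (explode ⊢○φ ⊢φ ⊢~φ)
  ○-respected t t (⊢φ , ⊢~φ) (⊢○φ , _) = inj₁ (explode ⊢○φ ⊢φ ⊢~φ)

  ∧-respected : ∀ x y z → Decides Γ φ x → Decides Γ ψ y → Decides Γ (φ ⋀ ψ) z →
                Γ ⊢ ⊥ᶠ ⊎ z ≡ (x ∧ y)
  ∧-respected true  true  true  _ _ _ = inj₂ refl
  ∧-respected true  false false _ _ _ = inj₂ refl
  ∧-respected false _     false _ _ _ = inj₂ refl
  ∧-respected true  true  false ⊢φ ⊢ψ ⊢¬φ∧ψ = inj₁ (mp (∧-intro ⊢φ ⊢ψ) ⊢¬φ∧ψ)
  ∧-respected true  false true  _ ⊢¬ψ ⊢φ∧ψ = inj₁ (mp (∧-elimʳ ⊢φ∧ψ) ⊢¬ψ)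
  ∧-respected false _     true  ⊢¬φ _ ⊢φ∧ψ = inj₁ (mp (∧-elimˡ ⊢φ∧ψ) ⊢¬φ)

  ∨-respected : ∀ x y z → Decides Γ φ x → Decides Γ ψ y → Decides Γ (φ ⋁ ψ) z →
                Γ ⊢ ⊥ᶠ ⊎ z ≡ (x ∨ y)
  ∨-respected true  _     true  _ _ _ = inj₂ refl
  ∨-respected false true  true  _ _ _ = inj₂ refl
  ∨-respected false false false _ _ _ = inj₂ refl
  ∨-respected true  _     false ⊢φ _ ⊢¬φ∨ψ = inj₁ (mp (∨-introˡ ⊢φ) ⊢¬φ∨ψ)
  ∨-respected false true  false _ ⊢ψ ⊢¬φ∨ψ = inj₁ (mp (∨-introʳ ⊢ψ) ⊢¬φ∨ψ)
  ∨-respected false false true  ⊢¬φ ⊢¬ψ ⊢φ∨ψ = inj₁ (∨-elim ⊢φ∨ψ ⊢¬φ ⊢¬ψ)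

  ⇒-respected : ∀ x y z → Decides Γ φ x → Decides Γ ψ y → Decides Γ (φ ⇒ ψ) z →
                Γ ⊢ ⊥ᶠ ⊎ z ≡ (not x ∨ y)
  ⇒-respected true  true  true  _ _ _ = inj₂ refl
  ⇒-respected true  false false _ _ _ = inj₂ refl
  ⇒-respected false _     true  _ _ _ = inj₂ refl
  ⇒-respected true  true  false _ ⊢ψ ⊢¬φ⇒ψ = inj₁ (mp (mp ⊢ψ (axm (ax1 _ _))) ⊢¬φ⇒ψ)
  ⇒-respected true  false true  ⊢φ ⊢¬ψ ⊢φ⇒ψ = inj₁ (mp (mp ⊢φ ⊢φ⇒ψ) ⊢¬ψ)
  ⇒-respected false _     false ⊢¬φ _ ⊢¬φ⇒ψ = inj₁ (mp (¬ᶠ⇒⇒ ⊢¬φ) ⊢¬φ⇒ψ)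

  ~⇔-separates : ∀ x y → Γ ⊢ (~ φ) ⇔ (~ ψ) → Forces Γ φ x → Forces Γ ψ y →
                 Γ ⊢ ⊥ᶠ ⊎ (des x ≡ des y → x ≡ y)
  ~⇔-separates T T _ _ _ = inj₂ (const refl)
  ~⇔-separates t t _ _ _ = inj₂ (const refl)
  ~⇔-separates F F _ _ _ = inj₂ (const refl)
  ~⇔-separates T t ⊢⇔ (_ , ⊢¬~φ) (_ , ⊢~ψ) = inj₁ (mp (mp ⊢~ψ (∧-elimʳ ⊢⇔)) ⊢¬~φ)
  ~⇔-separates t T ⊢⇔ (_ , ⊢~φ) (_ , ⊢¬~ψ) = inj₁ (mp (mp ⊢~φ (∧-elimˡ ⊢⇔)) ⊢¬~ψ)
  ~⇔-separates T F _ _ _ = inj₂ λ ()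
  ~⇔-separates t F _ _ _ = inj₂ λ ()
  ~⇔-separates F T _ _ _ = inj₂ λ ()
  ~⇔-separates F t _ _ _ = inj₂ λ ()

  consistent-not-t : Γ ⊢ ○ φ → ∀ x → Forces Γ φ x → Γ ⊢ ⊥ᶠ ⊎ x ≢ t
  consistent-not-t _ T _ = inj₂ λ ()
  consistent-not-t _ F _ = inj₂ λ ()
  consistent-not-t ⊢○φ t (⊢φ , ⊢~φ) = inj₁ (explode ⊢○φ ⊢φ ⊢~φ)

-- Deterministic choices in M₁

neg : V → V
neg T = F
neg t = t
neg F = T

neg-∈¬ : ∀ x → neg x ∈¬ x
neg-∈¬ T = refl
neg-∈¬ t = refl
neg-∈¬ F = refl

∈¬⇒≡neg : ∀ x → y ∈¬ x → y ≡ neg x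
∈¬⇒≡neg T refl = refl
∈¬⇒≡neg t refl = refl
∈¬⇒≡neg F refl = refl

○-hinted : V → V → V
○-hinted t _ = F
○-hinted _ t = t
○-hinted _ _ = T

○-hinted-∈○ : ∀ x h → ○-hinted x h ∈○ x
○-hinted-∈○ T T = refl
○-hinted-∈○ T t = refl
○-hinted-∈○ T F = refl
○-hinted-∈○ t _ = refl
○-hinted-∈○ F T = refl
○-hinted-∈○ F t = refl
○-hinted-∈○ F F = refl

○-hinted-fix : ∀ x y → y ∈○ x → ○-hinted x y ≡ y
○-hinted-fix T T _ = refl
○-hinted-fix T t _ = refl
○-hinted-fix t F _ = refl
○-hinted-fix F T _ = refl
○-hinted-fix F t _ = refl

○-hinted-neg : ∀ x h → ○-hinted (neg x) h ≡ ○-hinted x h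
○-hinted-neg T T = refl
○-hinted-neg T t = refl
○-hinted-neg T F = refl
○-hinted-neg t _ = refl
○-hinted-neg F T = refl
○-hinted-neg F t = refl
○-hinted-neg F F = refl

○-hinted-classical : ∀ x h → x ≡ T ⊎ x ≡ F → h ≢ t → ○-hinted x h ≡ T
○-hinted-classical T T _ _ = refl
○-hinted-classical T F _ _ = refl
○-hinted-classical F T _ _ = refl
○-hinted-classical F F _ _ = refl
○-hinted-classical _ t _ h≢t = ⊥-elim (h≢t refl)
○-hinted-classical t _ (inj₁ ()) _
○-hinted-classical t _ (inj₂ ()) _

is-t : V → Bool
is-t t = true
is-t _ = false

is-t-∈¬ : ∀ x → y ∈¬ x → is-t y ≡ is-t x
is-t-∈¬ T refl = refl
is-t-∈¬ t refl = refl
is-t-∈¬ F refl = refl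

des-∈○ : ∀ x → y ∈○ x → des y ≡ not (is-t x)
des-∈○ T d = d
des-∈○ t refl = refl
des-∈○ F d = d

tab : Bool → V → V
tab true F = T
tab true r = r
tab false _ = F

tab-∈ : ∀ b r → ∈tab b (tab b r)
tab-∈ true T = refl
tab-∈ true t = refl
tab-∈ true F = refl
tab-∈ false _ = refl

tab-fix : ∀ b r → ∈tab b r → tab b r ≡ r
tab-fix true T _ = refl
tab-fix true t _ = refl
tab-fix false F _ = refl

tab-agrees : ∀ (op : Bool → Bool → Bool) {x x′ y y′ r} → x ≡ x′ → y ≡ y′ →
             ∈tab (op (des x′) (des y′)) r → tab (op (des x) (des y)) r ≡ r
tab-agrees op refl refl = tab-fix _ _

∈tab-des : ∀ b r → des r ≡ b → ∈tab b r
∈tab-des true _ d = d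
∈tab-des false F _ = refl

-- Admissible assignments extend to valuations in F_n^k

Coherent : (Form → V) → Form → Set
Coherent f (var _) = ⊤
Coherent f (~ φ) = f (~ φ) ∈¬ f φ
Coherent f (○ φ) = f (○ φ) ∈○ f φ
Coherent f (φ ⋀ ψ) = (f (φ ⋀ ψ) ∈∧ f φ) (f ψ)
Coherent f (φ ⋁ ψ) = (f (φ ⋁ ψ) ∈∨ f φ) (f ψ)
Coherent f (φ ⇒ ψ) = (f (φ ⇒ ψ) ∈⇒ f φ) (f ψ)

record Admissible (n k N : ℕ) (f : Form → V) : Set where
  field
    coherent : ∀ φ → rank φ ≤ N → Coherent f φ
    -- Only T and t need separating: coherence of ○ already equates the designations.
    ip-separated : ∀ m ρ → suc m < k → rank (○^ (suc m) (~ ρ)) ≤ N →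
                   des (f (○^ (suc m) (~ ρ))) ≡ des (f (○^ (suc m) ρ)) →
                   f (○^ (suc m) (~ ρ)) ≡ f (○^ (suc m) ρ)
    cc-consistent : ∀ β → f (○^ (suc n) β) ≢ t

module Extension (n k : ℕ) (f : Form → V) where

  -- canon m ψ represents ○^(suc m) ψ modulo (ip), which lets ~ pass through ○^j for j < k.
  canon : ℕ → Form → Form
  canon m (○ ψ) = canon (suc m) ψ
  canon m (~ ρ) with suc m <? k
  ... | yes _ = canon m ρ
  ... | no _ = ○^ (suc m) (~ ρ)
  canon m ψ = ○^ (suc m) ψ

  canon-~ : ∀ {m} ρ → suc m < k → canon m (~ ρ) ≡ canon m ρ
  canon-~ {m} ρ lt with suc m <? k
  ... | yes _ = refl
  ... | no ¬lt = ⊥-elim (¬lt lt)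

  canon-○^ : ∀ j ψ → canon 0 (○^ j ψ) ≡ canon j ψ
  canon-○^ j ψ = trans (shift 0 j) (cong (λ i → canon i ψ) (+-identityʳ j))
    where
    shift : ∀ m j → canon m (○^ j ψ) ≡ canon (j + m) ψ
    shift m zero = refl
    shift m (suc j) = trans (shift (suc m) j) (cong (λ i → canon i ψ) (+-suc j m))

  canon-tower : ∀ m ψ → ∃ λ b → canon m ψ ≡ ○^ (suc m) b
  canon-tower m (○ ψ) with canon-tower (suc m) ψ
  ... | b , e = ○ b , trans e (cong ○_ (sym (○^-○ m b)))
  canon-tower m (~ ρ) with suc m <? k
  ... | yes _ = canon-tower m ρ
  ... | no _ = ~ ρ , refl
  canon-tower m (var p) = var p , refl
  canon-tower m (φ ⋀ ψ) = φ ⋀ ψ , refl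
  canon-tower m (φ ⋁ ψ) = φ ⋁ ψ , refl
  canon-tower m (φ ⇒ ψ) = φ ⇒ ψ , refl

  ext : Form → V
  ext (var p) = f (var p)
  ext (~ φ) = neg (ext φ)
  ext (○ φ) = ○-hinted (ext φ) (f (canon 0 φ))
  ext (φ ⋀ ψ) = tab (des (ext φ) ∧ des (ext ψ)) (f (φ ⋀ ψ))
  ext (φ ⋁ ψ) = tab (des (ext φ) ∨ des (ext ψ)) (f (φ ⋁ ψ))
  ext (φ ⇒ ψ) = tab (not (des (ext φ)) ∨ des (ext ψ)) (f (φ ⇒ ψ))

  valuation : Valuation
  valuation = record
    { val = ext
    ; v-¬ = λ φ → neg-∈¬ (ext φ)
    ; v-○ = λ φ → ○-hinted-∈○ (ext φ) _
    ; v-∧ = λ _ _ → tab-∈ _ _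
    ; v-∨ = λ _ _ → tab-∈ _ _
    ; v-⇒ = λ _ _ → tab-∈ _ _
    }

  ext-ip : ∀ j → suc j < k → ∀ β → ext (○^ (suc j) (~ β)) ≡ ext (○^ (suc j) β)
  ext-ip j lt β = begin
      ○-hinted (ext (○^ j (~ β))) (f (canon 0 (○^ j (~ β))))
    ≡⟨ cong (○-hinted (ext (○^ j (~ β))) ∘ f) same-hint ⟩
      ○-hinted (ext (○^ j (~ β))) (f (canon 0 (○^ j β)))
    ≡⟨ same-argument j lt ⟩
      ○-hinted (ext (○^ j β)) (f (canon 0 (○^ j β)))
    ∎
    where
    same-hint : canon 0 (○^ j (~ β)) ≡ canon 0 (○^ j β)
    same-hint = begin
      canon 0 (○^ j (~ β)) ≡⟨ canon-○^ j (~ β) ⟩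
      canon j (~ β)        ≡⟨ canon-~ β lt ⟩
      canon j β            ≡⟨ canon-○^ j β ⟨
      canon 0 (○^ j β)     ∎
    same-argument : ∀ {h} j → suc j < k → ○-hinted (ext (○^ j (~ β))) h ≡ ○-hinted (ext (○^ j β)) h
    same-argument zero _ = ○-hinted-neg (ext β) _
    same-argument (suc j) lt = cong (λ x → ○-hinted x _) (ext-ip j (<⇒≤ lt) β)

  ext-cc : (∀ β → f (○^ (suc n) β) ≢ t) →
           ∀ β → ext (○^ n β) ≡ T ⊎ ext (○^ n β) ≡ F → ext (○^ (suc n) β) ≡ T
  ext-cc cc β classical with canon-tower n β
  ... | b , e = ○-hinted-classical _ _ classical
                  (subst (λ φ → f φ ≢ t) (sym (trans (canon-○^ n β) e)) (cc b))

  valuation-∈F : (∀ β → f (○^ (suc n) β) ≢ t) → InF n k valuation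
  valuation-∈F cc = ext-cc cc , λ { (suc j) _ lt β → sym (ext-ip j lt β) }

  module _ {N} (adm : Admissible n k N f) where
    open Admissible adm

    ip-agrees : ∀ m ρ → suc m < k → rank (○^ (suc m) (~ ρ)) ≤ N →
                f (○^ (suc m) (~ ρ)) ≡ f (○^ (suc m) ρ)
    is-t-agrees : ∀ m ρ → suc m < k → rank (○^ m (~ ρ)) ≤ N →
                  is-t (f (○^ m (~ ρ))) ≡ is-t (f (○^ m ρ))

    ip-agrees m ρ lt r = ip-separated m ρ lt r (begin
      des (f (○^ (suc m) (~ ρ))) ≡⟨ des-∈○ _ (coherent (○^ (suc m) (~ ρ)) r) ⟩
      not (is-t (f (○^ m (~ ρ))))  ≡⟨ cong not (is-t-agrees m ρ lt (<⇒≤ r)) ⟩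
      not (is-t (f (○^ m ρ)))      ≡⟨ des-∈○ _ (coherent (○^ (suc m) ρ) (rank-○^-~-≤ (suc m) r)) ⟨
      des (f (○^ (suc m) ρ))       ∎)

    is-t-agrees zero ρ _ r = is-t-∈¬ _ (coherent (~ ρ) r)
    is-t-agrees (suc m) ρ lt r = cong is-t (ip-agrees m ρ (<⇒≤ lt) r)

    canon-agrees : ∀ m ψ → rank (○^ (suc m) ψ) ≤ N → f (canon m ψ) ≡ f (○^ (suc m) ψ)
    canon-agrees m (○ ψ) r rewrite ○^-○ m ψ = canon-agrees (suc m) ψ r
    canon-agrees m (~ ρ) r with suc m <? k
    ... | yes lt = trans (canon-agrees m ρ (rank-○^-~-≤ (suc m) r))
                         (sym (ip-agrees m ρ lt r))
    ... | no _ = refl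
    canon-agrees m (var _) _ = refl
    canon-agrees m (_ ⋀ _) _ = refl
    canon-agrees m (_ ⋁ _) _ = refl
    canon-agrees m (_ ⇒ _) _ = refl

    ext-agrees : ∀ φ → rank φ ≤ N → ext φ ≡ f φ
    ext-agrees (var _) _ = refl
    ext-agrees (~ φ) r = trans (cong neg (ext-agrees φ (<⇒≤ r)))
                               (sym (∈¬⇒≡neg _ (coherent (~ φ) r)))
    ext-agrees (○ φ) r = trans (cong₂ ○-hinted (ext-agrees φ (<⇒≤ r)) (canon-agrees 0 φ r))
                               (○-hinted-fix _ _ (coherent (○ φ) r))
    ext-agrees (φ ⋀ ψ) r = tab-agrees _∧_
      (ext-agrees φ (m⊔n<o⇒m≤o r)) (ext-agrees ψ (m⊔n<o⇒n≤o r)) (coherent (φ ⋀ ψ) r)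
    ext-agrees (φ ⋁ ψ) r = tab-agrees _∨_
      (ext-agrees φ (m⊔n<o⇒m≤o r)) (ext-agrees ψ (m⊔n<o⇒n≤o r)) (coherent (φ ⋁ ψ) r)
    ext-agrees (φ ⇒ ψ) r = tab-agrees (λ a b → not a ∨ b)
      (ext-agrees φ (m⊔n<o⇒m≤o r)) (ext-agrees ψ (m⊔n<o⇒n≤o r)) (coherent (φ ⇒ ψ) r)

  admissible-designates-valid : ∀ {N φ} → Admissible n k N f → Valid n k φ → rank φ ≤ N →
                                Designated (f φ)
  admissible-designates-valid {φ = φ} adm valid r =
    subst Designated (ext-agrees adm φ r)
      (valid valuation (valuation-∈F (Admissible.cc-consistent adm)))

-- The branches of the case split

module _ {R : Set} where
  ∀∈-or : ∀ {A : Set} {Q : A → Set} (xs : List A) →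
          (∀ {a} → a ∈ xs → R ⊎ Q a) → R ⊎ (∀ {a} → a ∈ xs → Q a)
  ∀∈-or xs h = map₂ lookup (sequenceA 0ℓ (Sumₗ.applicative R 0ℓ) (tabulate h))

  assuming : ∀ {A B : Set} → Dec A → (A → R ⊎ B) → R ⊎ (A → B)
  assuming (yes a) h = map₂ const (h a)
  assuming (no ¬a) _ = inj₂ (⊥-elim ∘ ¬a)

module Branch (n k N : ℕ) (1≤k : 1 ≤ k) {Δ : List Form}
              (settled : All (Derivations.Settled n k Δ) (forms N)) where
  open Derivations n k
  open RawMonad (Sumₗ.monad (Δ ⊢ ⊥ᶠ) 0ℓ)

  value : Form → V
  value φ with rank φ ≤? N
  ... | yes r = proj₁ (lookup settled (∈-forms φ r))
  ... | no _ = F   -- unconstrained; F merely avoids t, as (cc) requires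

  value-forced : ∀ φ → rank φ ≤ N → Forces Δ φ (value φ)
  value-forced φ r with rank φ ≤? N
  ... | yes r′ = proj₂ (lookup settled (∈-forms φ r′))
  ... | no ¬r = ⊥-elim (¬r r)

  value-not-t : ∀ φ → (rank φ ≤ N → value φ ≢ t) → value φ ≢ t
  value-not-t φ h with rank φ ≤? N
  ... | yes r = h r
  ... | no _ = λ ()

  value-decided : ∀ φ → rank φ ≤ N → Decides Δ φ (des (value φ))
  value-decided φ r = forces⇒decides _ (value-forced φ r)

  ∀-bounded-or : ∀ {Q : Form → Set} → (∀ φ → rank φ ≤ N → Δ ⊢ ⊥ᶠ ⊎ Q φ) →
                 Δ ⊢ ⊥ᶠ ⊎ (∀ φ → rank φ ≤ N → Q φ)
  ∀-bounded-or h =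
    map₂ (λ all φ r → all (∈-forms φ r) r) (∀∈-or (forms N) λ {φ} _ → assuming (rank φ ≤? N) (h φ))

  coherent-or : ∀ φ → rank φ ≤ N → Δ ⊢ ⊥ᶠ ⊎ Coherent value φ
  coherent-or (var _) _ = inj₂ tt
  coherent-or (~ φ) r = ~-respected 1≤k _ _ (value-forced φ (<⇒≤ r)) (value-forced (~ φ) r)
  coherent-or (○ φ) r = ○-respected _ _ (value-forced φ (<⇒≤ r)) (value-forced (○ φ) r)
  coherent-or (φ ⋀ ψ) r = map₂ (∈tab-des _ _)
    (∧-respected _ _ _ (value-decided φ (m⊔n<o⇒m≤o r)) (value-decided ψ (m⊔n<o⇒n≤o r))
                        (value-decided (φ ⋀ ψ) r))
  coherent-or (φ ⋁ ψ) r = map₂ (∈tab-des _ _)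
    (∨-respected _ _ _ (value-decided φ (m⊔n<o⇒m≤o r)) (value-decided ψ (m⊔n<o⇒n≤o r))
                        (value-decided (φ ⋁ ψ) r))
  coherent-or (φ ⇒ ψ) r = map₂ (∈tab-des _ _)
    (⇒-respected _ _ _ (value-decided φ (m⊔n<o⇒m≤o r)) (value-decided ψ (m⊔n<o⇒n≤o r))
                        (value-decided (φ ⇒ ψ) r))

  IpSeparatedAt : Form → ℕ → Set
  IpSeparatedAt ρ m = suc m < k → rank (○^ (suc m) (~ ρ)) ≤ N →
                      des (value (○^ (suc m) (~ ρ))) ≡ des (value (○^ (suc m) ρ)) →
                      value (○^ (suc m) (~ ρ)) ≡ value (○^ (suc m) ρ)

  ip-separated-or : ∀ ρ → Δ ⊢ ⊥ᶠ ⊎ (∀ m → IpSeparatedAt ρ m)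
  ip-separated-or ρ =
    map₂ (λ all m lt → all (∈-upTo⁺ (<⇒≤ lt)) lt) (∀∈-or (upTo k) λ {m} _ → at-level m)
    where
    at-level : ∀ m → Δ ⊢ ⊥ᶠ ⊎ IpSeparatedAt ρ m
    at-level m = assuming (suc m <? k) λ lt → assuming (_ ≤? N) λ r →
      ~⇔-separates _ _ (axm (ip (suc m) (s≤s z≤n) lt ρ))
        (value-forced (○^ (suc m) (~ ρ)) r) (value-forced (○^ (suc m) ρ) (rank-○^-~-≤ (suc m) r))

  cc-or : ∀ β → Δ ⊢ ⊥ᶠ ⊎ (rank (○^ (suc n) β) ≤ N → value (○^ (suc n) β) ≢ t)
  cc-or β = assuming (_ ≤? N) λ r → consistent-not-t ⊢○^n+2β _ (value-forced (○^ (suc n) β) r)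
    where
    ⊢○^n+2β : Δ ⊢ ○^ (2 + n) β
    ⊢○^n+2β = subst (λ j → Δ ⊢ ○^ j β) (+-comm n 2) (axm (ccn β))

  admissible-or-inconsistent : Δ ⊢ ⊥ᶠ ⊎ Admissible n k N value
  admissible-or-inconsistent = do
    coherent ← ∀-bounded-or coherent-or
    separated ← ∀-bounded-or (λ ρ _ → ip-separated-or ρ)
    cc ← ∀-bounded-or (λ β _ → cc-or β)
    pure record
      { coherent = coherent
      ; ip-separated = λ m ρ lt r → separated ρ (<⇒≤ (rank-○^-≤ (suc m) r)) m lt r
      ; cc-consistent = λ β → value-not-t (○^ (suc n) β) λ r → cc β (rank-○^-≤ (suc n) r) r
      }

theorem27 : ∀ (n k : ℕ) → 2 ≤ k → ∀ (α : Form) → Valid n k α → Thm n k α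
theorem27 n k 2≤k α valid = ⊢⇒Thm (settle (forms (rank α)) derive)
  where
  open Derivations n k
  derive : ∀ {Δ} → [] ⊆ Δ → All (Settled Δ) (forms (rank α)) → Δ ⊢ α
  derive _ settled = [ ⊥ᶠ-elim , designated ]′ admissible-or-inconsistent
    where
    open Branch n k (rank α) (<⇒≤ 2≤k) settled
    designated : Admissible n k (rank α) value → _ ⊢ α
    designated adm = forces-designated _
      (Extension.admissible-designates-valid n k value adm valid ≤-refl) (value-forced α ≤-refl)
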